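{- For every $n\ge0$, the map $\mathbf{Dyck}$ restricts to a bijection from the set of compacted binary trees of size $n$ onto the set of C-decorated Dyck paths of length $2n$ (i.e. C-decorated paths ending at $(n,n)$).
   Context: A relaxed binary tree of size $n$ is a DAG obtained from a plane binary tree $C_*$ with $n$ internal nodes (the spine) by keeping the left-most leaf and turning every other leaf into a pointer to a node (internal node or left-most leaf) preceding that leaf in postorder. For a node $u$, $B(u)$ is the binary tree equal to a single leaf if $u$ is the left-most leaf and otherwise having $B(v),B(w)$ as left/right subtrees, $v,w$ the left/right children of $u$ (pointers followed to their targets); a compacted binary tree is a relaxed tree with $B(u)\not\cong B(v)$ for all distinct nodes $u,v$. A horizontally decorated path is a lattice path from $(0,0)$ with steps $H=(1,0)$, $V=(0,1)$ staying in $0\le y\le x$, each $H$ step at height $k$ decorated by an element of $\{1,\dots,k+1\}$. The map $\mathbf{Dyck}$ (a bijection from relaxed trees of size $n$ to horizontally decorated paths ending at $(n,n)$): label the internal nodes and the left-most leaf of $C_*$ in postorder by $1,\dots,n+1$; define $\mathbf{Path}(\text{leaf})=H$ and $\mathbf{Path}((T_1,T_2))=\mathbf{Path}(T_1)\mathbf{Path}(T_2)V$ for a tree with left and right subtrees $T_1,T_2$; let $P_0$ be $\mathbf{Path}(C_*)$ with its first step (the $H$ of the left-most leaf) removed; each $H$ step of $P_0$ corresponds to a non-left-most leaf, i.e. a pointer, and is decorated by the label of the node that pointer points to. C-decorated paths: in a horizontally decorated path give each step $S$ a label $\mathcal{L}(S)$: for an $H$ step its decoration, for a $V$ step the $y$-coordinate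 of its endpoint plus one. To each $V$ step associate a pair $(v_1,v_2)$: $v_2=\mathcal{L}(S')$ with $S'$ the step immediately before this $V$; draw from the endpoint of this $V$ the line in south-west direction parallel to the diagonal $y=x$, stopping upon touching the path again, let $S''$ be the last step before this $V$ that ends on this line and set $v_1=\mathcal{L}(S'')$, or $v_1=1$ if there is no such step. A C-decorated path is a horizontally decorated path such that for every occurrence of three consecutive steps $HHV$, the decorations $h_1,h_2$ of its two $H$ steps satisfy $(h_1,h_2)\neq(v_1,v_2)$ for every $V$ step preceding this occurrence. -}

module Defs where

open import Data.Nat using (ℕ; zero; suc; _+_; _∸_; _≤_; _≟_)
open import Data.Bool using (Bool; true; false)
open import Data.List using (List; []; _∷_; _++_; [_]; drop)
open import Data.Product using (_×_; _,_; proj₁; proj₂)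
open import Relation.Binary.PropositionalEquality using (_≡_)
open import Relation.Nullary using (¬_; yes; no)
open import Data.List.Relation.Binary.Pointwise using (Pointwise)
open import Data.List.Relation.Unary.Unique.Propositional using (Unique)

-- Plane binary trees (used both for spines C_* and for the trees B(u))

data Bin : Set where
  leaf : Bin
  node : Bin → Bin → Bin

size : Bin → ℕ
size leaf       = 0
size (node l r) = suc (size l + size r)

data Kind : Set where
  leafK nodeK : Kind

postorder : Bin → List Kind
postorder leaf       = leafK ∷ []
postorder (node l r) = postorder l ++ postorder r ++ [ nodeK ]

-- The left-most leaf is the first node in postorder.  Labelled nodes are
-- the left-most leaf and the internal nodes (labels 1,2,... in postorder).
-- For each non-left-most leaf (in postorder) this gives the number k of
-- labelled nodes preceding it in postorder; i.e. the nodes a pointer at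
-- that leaf may point to are exactly those with labels 1..k.
availFrom : ℕ → List Kind → List ℕ
availFrom k []            = []
availFrom k (leafK ∷ ks)  = k ∷ availFrom k ks
availFrom k (nodeK ∷ ks)  = availFrom (suc k) ks

avail : Bin → List ℕ
avail t = availFrom 1 (drop 1 (postorder t))

-- Relaxed binary trees: a spine together with, for each non-left-most
-- leaf in postorder, the label of the node it points to.

record RelaxedTree : Set where
  constructor relaxed
  field
    spine : Bin
    ptrs  : List ℕ
    valid : Pointwise (λ p k → 1 ≤ p × p ≤ k) ptrs (avail spine)

open RelaxedTree public

HasSize : ℕ → RelaxedTree → Set
HasSize n T = size (spine T) ≡ n

-- 1-based lookup (default only used for out-of-range labels)
at : List Bin → ℕ → Bin
at []       _             = leaf
at (b ∷ bs) zero          = leaf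
at (b ∷ bs) (suc zero)    = b
at (b ∷ bs) (suc (suc i)) = at bs (suc i)

-- traverse the spine in postorder; the Bool flags the left-most leaf;
-- the environment lists B(1), B(2), ... for the labels seen so far;
-- returns B of the current node, updated environment, remaining pointers
walkB : Bin → Bool → List Bin → List ℕ → Bin × List Bin × List ℕ
walkB leaf true  env ps       = leaf , env ++ [ leaf ] , ps
walkB leaf false env []       = leaf , env , []
walkB leaf false env (p ∷ ps) = at env p , env , ps
walkB (node l r) b env ps with walkB l b env ps
... | bl , e₁ , ps₁ with walkB r false e₁ ps₁
... | br , e₂ , ps₂ = node bl br , e₂ ++ [ node bl br ] , ps₂

-- [ B(1) , B(2) , ... , B(n+1) ]
Bs : RelaxedTree → List Bin
Bs T = proj₁ (proj₂ (walkB (spine T) true [] (ptrs T)))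

Compacted : RelaxedTree → Set
Compacted T = Unique (Bs T)

data Step : Set where
  H : ℕ → Step
  V : Step

Walk : ℕ → ℕ → List Step → ℕ → ℕ → Set
Walk x y []         x' y' = (x ≡ x') × (y ≡ y')
Walk x y (H d ∷ ps) x' y' = (1 ≤ d × d ≤ suc y) × Walk (suc x) y ps x' y'
Walk x y (V ∷ ps)   x' y' = (suc y ≤ x) × Walk x (suc y) ps x' y'

HDecPath : ℕ → List Step → Set
HDecPath n P = Walk 0 0 P n n

-- for each step (from the origin): endpoint x, endpoint y, label 𝓛
annotate : ℕ → ℕ → List Step → List (ℕ × ℕ × ℕ)
annotate x y []         = []
annotate x y (H d ∷ ps) = (suc x , y , d) ∷ annotate (suc x) y ps
annotate x y (V ∷ ps)   = (x , suc y , suc (suc y)) ∷ annotate x (suc y) ps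

endX endY : List Step → ℕ
endX []         = 0
endX (H _ ∷ ps) = suc (endX ps)
endX (V ∷ ps)   = endX ps
endY []         = 0
endY (H _ ∷ ps) = endY ps
endY (V ∷ ps)   = suc (endY ps)

lastLabel : ℕ → List (ℕ × ℕ × ℕ) → ℕ
lastLabel d []                 = d
lastLabel d ((_ , _ , l) ∷ as) = lastLabel l as

lastOnLine : ℕ → ℕ → List (ℕ × ℕ × ℕ) → ℕ
lastOnLine c d []                  = d
lastOnLine c d ((x , y , l) ∷ as) with x ≟ y + c
... | yes _ = lastOnLine c l as
... | no  _ = lastOnLine c d as

-- the pair (v₁ , v₂) of a V step, given the prefix Q of steps before it.
-- The V step ends at (endX Q , endY Q + 1); its south-west line is
-- x' − y' = endX Q − (endY Q + 1).
vPair : List Step → ℕ × ℕ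
vPair Q = lastOnLine (endX Q ∸ suc (endY Q)) 1 A , lastLabel 1 A
  where A = annotate 0 0 Q

CCondition : List Step → Set
CCondition P =
  (pre post : List Step) (h₁ h₂ : ℕ) → P ≡ pre ++ (H h₁ ∷ H h₂ ∷ V ∷ post) →
  (Q R : List Step) → pre ≡ Q ++ (V ∷ R) →
  ¬ ((h₁ ≡ proj₁ (vPair Q)) × (h₂ ≡ proj₂ (vPair Q)))

CDyckPath : ℕ → List Step → Set
CDyckPath n P = HDecPath n P × CCondition P

data Move : Set where
  h v : Move

Path : Bin → List Move
Path leaf       = h ∷ []
Path (node l r) = Path l ++ Path r ++ [ v ]

decorate : List Move → List ℕ → List Step
decorate []      ps       = []
decorate (v ∷ m) ps       = V ∷ decorate m ps
decorate (h ∷ m) []       = H 0 ∷ decorate m []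
decorate (h ∷ m) (p ∷ ps) = H p ∷ decorate m ps

Dyck : RelaxedTree → List Step
Dyck T = decorate (drop 1 (Path (spine T))) (ptrs T)

-- The proof is organised around a stack machine, the decoder, that reads a
-- decorated path from left to right: a step H d pushes a leaf pointing to d,
-- a step V pops the two topmost subtrees, joins them under a new internal node
-- (receiving the next label) and appends the tree B of that node to an
-- environment.
module Submission where

open import Defs
open import Data.Nat using (ℕ; zero; suc; _+_; _∸_; _≤_; _<_; z≤n; s≤s; _≟_)
open import Data.Nat.Properties
open import Data.Nat.Tactic.RingSolver using (solve-∀)
open import Data.Bool using (true; false)
open import Data.List using (List; []; _∷_; _++_; [_]; drop; length)
open import Data.List.Properties using (++-assoc; ++-identityʳ; length-++; ∷-injective)
open import Data.List.Relation.Unary.All as All using (All; []; _∷_)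
open import Data.List.Relation.Unary.AllPairs.Core using ([]; _∷_)
open import Data.List.Relation.Unary.Unique.Propositional using (Unique)
open import Data.List.Relation.Binary.Pointwise using (Pointwise; []; _∷_; ++⁺; Pointwise-length)
open import Data.Product using (Σ; _×_; _,_; proj₁; proj₂; map₂)
open import Data.Sum using (_⊎_; inj₁; inj₂)
open import Data.Unit using (⊤; tt)
open import Data.Empty using (⊥; ⊥-elim)
open import Function.Bundles using (_⇔_; mk⇔; Equivalence)
open import Relation.Binary.PropositionalEquality hiding ([_])
open import Relation.Nullary using (¬_; yes; no)

open Equivalence using (to; from)

+-suc-right : ∀ a b → a + (b + 1) ≡ suc (a + b)
+-suc-right = solve-∀

suc-+-suc : ∀ a b → suc a + (suc b + 0) ≡ suc (suc (a + b))
suc-+-suc = solve-∀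

+-one : ∀ n → n + 1 ≡ suc n
+-one = solve-∀

additive-join : ∀ {X : Set} (f : List X → ℕ) → (∀ A B → f (A ++ B) ≡ f A + f B) →
  ∀ A B C → f (A ++ B ++ C) ≡ f A + (f B + f C)
additive-join f f-++ A B C = trans (f-++ A (B ++ C)) (cong (f A +_) (f-++ B C))

countNodes countLeaves : List Kind → ℕ
countNodes []           = 0
countNodes (leafK ∷ ks) = countNodes ks
countNodes (nodeK ∷ ks) = suc (countNodes ks)
countLeaves []           = 0
countLeaves (leafK ∷ ks) = suc (countLeaves ks)
countLeaves (nodeK ∷ ks) = countLeaves ks

countNodes-++ : ∀ A B → countNodes (A ++ B) ≡ countNodes A + countNodes B
countNodes-++ []          B = refl
countNodes-++ (leafK ∷ A) B = countNodes-++ A B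
countNodes-++ (nodeK ∷ A) B = cong suc (countNodes-++ A B)

countLeaves-++ : ∀ A B → countLeaves (A ++ B) ≡ countLeaves A + countLeaves B
countLeaves-++ []          B = refl
countLeaves-++ (leafK ∷ A) B = cong suc (countLeaves-++ A B)
countLeaves-++ (nodeK ∷ A) B = countLeaves-++ A B

nodes-postorder : ∀ t → countNodes (postorder t) ≡ size t
nodes-postorder leaf       = refl
nodes-postorder (node l r) = begin
  countNodes (postorder l ++ postorder r ++ [ nodeK ])
    ≡⟨ additive-join countNodes countNodes-++ (postorder l) (postorder r) _ ⟩
  countNodes (postorder l) + (countNodes (postorder r) + 1)
    ≡⟨ cong₂ (λ a b → a + (b + 1)) (nodes-postorder l) (nodes-postorder r) ⟩
  size l + (size r + 1)
    ≡⟨ +-suc-right (size l) (size r) ⟩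
  suc (size l + size r) ∎
  where open ≡-Reasoning

leaves-postorder : ∀ t → countLeaves (postorder t) ≡ suc (size t)
leaves-postorder leaf       = refl
leaves-postorder (node l r) = begin
  countLeaves (postorder l ++ postorder r ++ [ nodeK ])
    ≡⟨ additive-join countLeaves countLeaves-++ (postorder l) (postorder r) _ ⟩
  countLeaves (postorder l) + (countLeaves (postorder r) + 0)
    ≡⟨ cong₂ (λ a b → a + (b + 0)) (leaves-postorder l) (leaves-postorder r) ⟩
  suc (size l) + (suc (size r) + 0)
    ≡⟨ suc-+-suc (size l) (size r) ⟩
  suc (size (node l r)) ∎
  where open ≡-Reasoning

-- Both traversals of a tree start with its left-most leaf; this first
-- element is the one removed in avail and in Dyck.

postorder-leftmost : ∀ t → Σ (List Kind) λ ks → postorder t ≡ leafK ∷ ks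
postorder-leftmost leaf       = [] , refl
postorder-leftmost (node l r) with postorder-leftmost l
... | ks , eq = ks ++ postorder r ++ [ nodeK ] , cong (_++ postorder r ++ [ nodeK ]) eq

Path-leftmost : ∀ t → Σ (List Move) λ ms → Path t ≡ h ∷ ms
Path-leftmost leaf       = [] , refl
Path-leftmost (node l r) with Path-leftmost l
... | ms , eq = ms ++ Path r ++ [ v ] , cong (_++ Path r ++ [ v ]) eq

drop1-postorder-++ : ∀ t ks → drop 1 (postorder t ++ ks) ≡ drop 1 (postorder t) ++ ks
drop1-postorder-++ t ks with postorder-leftmost t
... | _ , eq rewrite eq = refl

drop1-Path-++ : ∀ t ms → drop 1 (Path t ++ ms) ≡ drop 1 (Path t) ++ ms
drop1-Path-++ t ms with Path-leftmost t
... | _ , eq rewrite eq = refl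

nodes-postorder⁻ : ∀ t → countNodes (drop 1 (postorder t)) ≡ size t
nodes-postorder⁻ t with postorder-leftmost t | nodes-postorder t
... | _ , eq | count rewrite eq = count

leaves-postorder⁻ : ∀ t → countLeaves (drop 1 (postorder t)) ≡ size t
leaves-postorder⁻ t with postorder-leftmost t | leaves-postorder t
... | _ , eq | count rewrite eq = suc-injective count

length-availFrom : ∀ k A → length (availFrom k A) ≡ countLeaves A
length-availFrom k []           = refl
length-availFrom k (leafK ∷ A) = cong suc (length-availFrom k A)
length-availFrom k (nodeK ∷ A) = length-availFrom (suc k) A

availFrom-++ : ∀ k A B → availFrom k (A ++ B) ≡ availFrom k A ++ availFrom (k + countNodes A) B
availFrom-++ k []           B = cong (λ j → availFrom j B) (sym (+-identityʳ k))
availFrom-++ k (leafK ∷ A) B = cong (k ∷_) (availFrom-++ k A B)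
availFrom-++ k (nodeK ∷ A) B = trans (availFrom-++ (suc k) A B)
  (cong (λ j → availFrom (suc k) A ++ availFrom j B) (sym (+-suc k (countNodes A))))

-- The bounds of the leaves of (node l r) after those of the part A of l:
-- the leaves of r may additionally point to the internal nodes of A.
availFrom-join : ∀ k A r →
  availFrom k (A ++ postorder r ++ [ nodeK ]) ≡ availFrom k A ++ availFrom (k + countNodes A) (postorder r)
availFrom-join k A r = begin
  availFrom k (A ++ postorder r ++ [ nodeK ])
    ≡⟨ availFrom-++ k A _ ⟩
  availFrom k A ++ availFrom (k + countNodes A) (postorder r ++ [ nodeK ])
    ≡⟨ cong (availFrom k A ++_) (availFrom-++ _ (postorder r) [ nodeK ]) ⟩
  availFrom k A ++ availFrom (k + countNodes A) (postorder r) ++ []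
    ≡⟨ cong (availFrom k A ++_) (++-identityʳ _) ⟩
  availFrom k A ++ availFrom (k + countNodes A) (postorder r) ∎
  where open ≡-Reasoning

availFrom-node : ∀ k l r →
  availFrom k (postorder (node l r)) ≡ availFrom k (postorder l) ++ availFrom (k + size l) (postorder r)
availFrom-node k l r = trans (availFrom-join k (postorder l) r)
  (cong (λ j → availFrom k (postorder l) ++ availFrom (k + j) (postorder r)) (nodes-postorder l))

availFrom-node⁻ : ∀ k l r →
  availFrom k (drop 1 (postorder (node l r)))
    ≡ availFrom k (drop 1 (postorder l)) ++ availFrom (k + size l) (postorder r)
availFrom-node⁻ k l r = begin
  availFrom k (drop 1 (postorder l ++ postorder r ++ [ nodeK ]))
    ≡⟨ cong (availFrom k) (drop1-postorder-++ l _) ⟩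
  availFrom k (drop 1 (postorder l) ++ postorder r ++ [ nodeK ])
    ≡⟨ availFrom-join k (drop 1 (postorder l)) r ⟩
  availFrom k (drop 1 (postorder l)) ++ availFrom (k + countNodes (drop 1 (postorder l))) (postorder r)
    ≡⟨ cong (λ j → availFrom k (drop 1 (postorder l)) ++ availFrom (k + j) (postorder r)) (nodes-postorder⁻ l) ⟩
  availFrom k (drop 1 (postorder l)) ++ availFrom (k + size l) (postorder r) ∎
  where open ≡-Reasoning

hMoves : List Move → ℕ
hMoves []      = 0
hMoves (h ∷ m) = suc (hMoves m)
hMoves (v ∷ m) = hMoves m

hMoves-++ : ∀ A B → hMoves (A ++ B) ≡ hMoves A + hMoves B
hMoves-++ []      B = refl
hMoves-++ (h ∷ A) B = cong suc (hMoves-++ A B)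
hMoves-++ (v ∷ A) B = hMoves-++ A B

hMoves-Path : ∀ t → hMoves (Path t) ≡ suc (size t)
hMoves-Path leaf       = refl
hMoves-Path (node l r) = begin
  hMoves (Path l ++ Path r ++ [ v ])
    ≡⟨ additive-join hMoves hMoves-++ (Path l) (Path r) _ ⟩
  hMoves (Path l) + (hMoves (Path r) + 0)
    ≡⟨ cong₂ (λ a b → a + (b + 0)) (hMoves-Path l) (hMoves-Path r) ⟩
  suc (size l) + (suc (size r) + 0)
    ≡⟨ suc-+-suc (size l) (size r) ⟩
  suc (size (node l r)) ∎
  where open ≡-Reasoning

hMoves-Path⁻ : ∀ t → hMoves (drop 1 (Path t)) ≡ size t
hMoves-Path⁻ t with Path-leftmost t | hMoves-Path t
... | _ , eq | count rewrite eq = suc-injective count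

decorate-++ : ∀ m₁ m₂ p₁ p₂ → length p₁ ≡ hMoves m₁ →
  decorate (m₁ ++ m₂) (p₁ ++ p₂) ≡ decorate m₁ p₁ ++ decorate m₂ p₂
decorate-++ []       m₂ []       p₂ _  = refl
decorate-++ (v ∷ m₁) m₂ p₁       p₂ eq = cong (V ∷_) (decorate-++ m₁ m₂ p₁ p₂ eq)
decorate-++ (h ∷ m₁) m₂ (p ∷ p₁) p₂ eq = cong (H p ∷_) (decorate-++ m₁ m₂ p₁ p₂ (suc-injective eq))

decorate-join : ∀ ml r pl pr → length pl ≡ hMoves ml → length pr ≡ suc (size r) →
  decorate (ml ++ Path r ++ [ v ]) (pl ++ pr) ≡ decorate ml pl ++ decorate (Path r) pr ++ [ V ]
decorate-join ml r pl pr eql eqr = begin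
  decorate (ml ++ Path r ++ [ v ]) (pl ++ pr)
    ≡⟨ decorate-++ ml _ pl pr eql ⟩
  decorate ml pl ++ decorate (Path r ++ [ v ]) pr
    ≡⟨ cong (λ ps → decorate ml pl ++ decorate (Path r ++ [ v ]) ps) (sym (++-identityʳ pr)) ⟩
  decorate ml pl ++ decorate (Path r ++ [ v ]) (pr ++ [])
    ≡⟨ cong (decorate ml pl ++_) (decorate-++ (Path r) [ v ] pr [] (trans eqr (sym (hMoves-Path r)))) ⟩
  decorate ml pl ++ decorate (Path r) pr ++ [ V ] ∎
  where open ≡-Reasoning

ValidPtrs : List ℕ → List ℕ → Set
ValidPtrs = Pointwise (λ p k → 1 ≤ p × p ≤ k)

splitAtLength : ∀ {X : Set} (xs : List X) m n → length xs ≡ m + n →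
  Σ (List X) λ as → Σ (List X) λ bs → xs ≡ as ++ bs × length as ≡ m × length bs ≡ n
splitAtLength xs       zero    n eq = [] , xs , refl , refl , eq
splitAtLength (x ∷ xs) (suc m) n eq with splitAtLength xs m n (suc-injective eq)
... | as , bs , refl , eqa , eqb = x ∷ as , bs , refl , cong suc eqa , eqb

Pointwise-++⁻ : ∀ {X Y : Set} {R : X → Y → Set} (ws : List X) {xs ys zs} → length ws ≡ length xs →
  Pointwise R (ws ++ ys) (xs ++ zs) → Pointwise R ws xs × Pointwise R ys zs
Pointwise-++⁻ []       {[]}     _  rs       = [] , rs
Pointwise-++⁻ (w ∷ ws) {x ∷ xs} eq (r ∷ rs) with Pointwise-++⁻ ws {xs} (suc-injective eq) rs
... | rs₁ , rs₂ = r ∷ rs₁ , rs₂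

Walk-resp : ∀ {x₁ x₂ y₁ y₂ P x' y'} → x₁ ≡ x₂ → y₁ ≡ y₂ → Walk x₁ y₁ P x' y' → Walk x₂ y₂ P x' y'
Walk-resp refl refl w = w

after-join : ∀ x a b → x + suc a + suc b ≡ x + suc (suc (a + b))
after-join = solve-∀

after-join⁻ : ∀ x a b → x + a + suc b ≡ x + suc (a + b)
after-join⁻ = solve-∀

height-join : ∀ y a b → suc (y + a + b) ≡ y + suc (a + b)
height-join = solve-∀

join-fits⁻ : ∀ {x y} a b → y ≤ x → suc (y + a + b) ≤ x + a + suc b
join-fits⁻ {x} a b y≤x = ≤-trans (s≤s (+-monoˡ-≤ b (+-monoˡ-≤ a y≤x))) (≤-reflexive (sym (+-suc (x + a) b)))

join-fits : ∀ {x y} a b → y ≤ x → suc (y + a + b) ≤ x + suc a + suc b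
join-fits {x} a b y≤x = ≤-trans (join-fits⁻ a b y≤x) (+-monoˡ-≤ (suc b) (+-monoʳ-≤ x (n≤1+n a)))

path-join-++ : ∀ (A B C D : List Move) → (A ++ B ++ C) ++ D ≡ A ++ B ++ C ++ D
path-join-++ A B C D = trans (++-assoc A (B ++ C) D) (cong (A ++_) (++-assoc B C D))

walk-subtree : ∀ t x y ps rest m x' y' → y ≤ x → length ps ≡ suc (size t) →
  Walk x y (decorate (Path t ++ m) (ps ++ rest)) x' y' ⇔
  (ValidPtrs ps (availFrom (suc y) (postorder t))
    × Walk (x + suc (size t)) (y + size t) (decorate m rest) x' y')
walk-subtree leaf x y (p ∷ []) rest m x' y' _ _ = mk⇔
  (λ (bounds , w) → bounds ∷ [] , Walk-resp (sym (+-one x)) (sym (+-identityʳ y)) w)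
  (λ { (bounds ∷ [] , w) → bounds , Walk-resp (+-one x) (+-identityʳ y) w })
walk-subtree (node l r) x y ps rest m x' y' y≤x len
  with splitAtLength ps (suc (size l)) (suc (size r)) (trans len (cong suc (sym (+-suc (size l) (size r)))))
... | pl , pr , refl , lenl , lenr = mk⇔ forward backward
  where
  sl sr : ℕ
  sl = size l
  sr = size r
  Lhs Rhs : Set
  Lhs = Walk x y (decorate (Path (node l r) ++ m) ((pl ++ pr) ++ rest)) x' y'
  Rhs = ValidPtrs (pl ++ pr) (availFrom (suc y) (postorder (node l r)))
        × Walk (x + suc (size (node l r))) (y + size (node l r)) (decorate m rest) x' y'
  reassoc : decorate (Path (node l r) ++ m) ((pl ++ pr) ++ rest)
          ≡ decorate (Path l ++ Path r ++ v ∷ m) (pl ++ pr ++ rest)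
  reassoc = cong₂ decorate (path-join-++ (Path l) (Path r) [ v ] m) (++-assoc pl pr rest)
  left : Walk x y (decorate (Path l ++ Path r ++ v ∷ m) (pl ++ pr ++ rest)) x' y'
         ⇔ (ValidPtrs pl (availFrom (suc y) (postorder l))
             × Walk (x + suc sl) (y + sl) (decorate (Path r ++ v ∷ m) (pr ++ rest)) x' y')
  left = walk-subtree l x y pl (pr ++ rest) (Path r ++ v ∷ m) x' y' y≤x lenl
  right : Walk (x + suc sl) (y + sl) (decorate (Path r ++ v ∷ m) (pr ++ rest)) x' y'
          ⇔ (ValidPtrs pr (availFrom (suc y + sl) (postorder r))
              × Walk (x + suc sl + suc sr) (y + sl + sr) (decorate (v ∷ m) rest) x' y')
  right = walk-subtree r (x + suc sl) (y + sl) pr rest (v ∷ m) x' y'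
            (≤-trans (+-monoˡ-≤ sl y≤x) (+-monoʳ-≤ x (n≤1+n sl))) lenr
  bounds : availFrom (suc y) (postorder (node l r))
         ≡ availFrom (suc y) (postorder l) ++ availFrom (suc y + sl) (postorder r)
  bounds = availFrom-node (suc y) l r
  forward : Lhs → Rhs
  forward w with to left (subst (λ P → Walk x y P x' y') reassoc w)
  ... | okl , wl with to right wl
  ... | okr , (_ , wr) = subst (ValidPtrs (pl ++ pr)) (sym bounds) (++⁺ okl okr)
                       , Walk-resp (after-join x sl sr) (height-join y sl sr) wr
  backward : Rhs → Lhs
  backward (ok , w)
    with Pointwise-++⁻ pl (trans lenl (sym (trans (length-availFrom (suc y) (postorder l)) (leaves-postorder l))))
                         (subst (ValidPtrs (pl ++ pr)) bounds ok)
  ... | okl , okr = subst (λ P → Walk x y P x' y') (sym reassoc)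
        (from left (okl , from right (okr , (join-fits sl sr y≤x ,
          Walk-resp (sym (after-join x sl sr)) (sym (height-join y sl sr)) w))))

walk-spine : ∀ t x y ps rest m x' y' → y ≤ x → length ps ≡ size t →
  Walk x y (decorate (drop 1 (Path t ++ m)) (ps ++ rest)) x' y' ⇔
  (ValidPtrs ps (availFrom (suc y) (drop 1 (postorder t)))
    × Walk (x + size t) (y + size t) (decorate m rest) x' y')
walk-spine leaf x y [] rest m x' y' _ _ = mk⇔
  (λ w → [] , Walk-resp (sym (+-identityʳ x)) (sym (+-identityʳ y)) w)
  (λ { ([] , w) → Walk-resp (+-identityʳ x) (+-identityʳ y) w })
walk-spine (node l r) x y ps rest m x' y' y≤x len
  with splitAtLength ps (size l) (suc (size r)) (trans len (sym (+-suc (size l) (size r))))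
... | pl , pr , refl , lenl , lenr = mk⇔ forward backward
  where
  sl sr : ℕ
  sl = size l
  sr = size r
  Lhs Rhs : Set
  Lhs = Walk x y (decorate (drop 1 (Path (node l r) ++ m)) ((pl ++ pr) ++ rest)) x' y'
  Rhs = ValidPtrs (pl ++ pr) (availFrom (suc y) (drop 1 (postorder (node l r))))
        × Walk (x + size (node l r)) (y + size (node l r)) (decorate m rest) x' y'
  reassoc : decorate (drop 1 (Path (node l r) ++ m)) ((pl ++ pr) ++ rest)
          ≡ decorate (drop 1 (Path l ++ Path r ++ v ∷ m)) (pl ++ pr ++ rest)
  reassoc = cong₂ (λ ms → decorate (drop 1 ms)) (path-join-++ (Path l) (Path r) [ v ] m) (++-assoc pl pr rest)
  left : Walk x y (decorate (drop 1 (Path l ++ Path r ++ v ∷ m)) (pl ++ pr ++ rest)) x' y'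
         ⇔ (ValidPtrs pl (availFrom (suc y) (drop 1 (postorder l)))
             × Walk (x + sl) (y + sl) (decorate (Path r ++ v ∷ m) (pr ++ rest)) x' y')
  left = walk-spine l x y pl (pr ++ rest) (Path r ++ v ∷ m) x' y' y≤x lenl
  right : Walk (x + sl) (y + sl) (decorate (Path r ++ v ∷ m) (pr ++ rest)) x' y'
          ⇔ (ValidPtrs pr (availFrom (suc y + sl) (postorder r))
              × Walk (x + sl + suc sr) (y + sl + sr) (decorate (v ∷ m) rest) x' y')
  right = walk-subtree r (x + sl) (y + sl) pr rest (v ∷ m) x' y' (+-monoˡ-≤ sl y≤x) lenr
  bounds : availFrom (suc y) (drop 1 (postorder (node l r)))
         ≡ availFrom (suc y) (drop 1 (postorder l)) ++ availFrom (suc y + sl) (postorder r)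
  bounds = availFrom-node⁻ (suc y) l r
  forward : Lhs → Rhs
  forward w with to left (subst (λ P → Walk x y P x' y') reassoc w)
  ... | okl , wl with to right wl
  ... | okr , (_ , wr) = subst (ValidPtrs (pl ++ pr)) (sym bounds) (++⁺ okl okr)
                       , Walk-resp (after-join⁻ x sl sr) (height-join y sl sr) wr
  backward : Rhs → Lhs
  backward (ok , w)
    with Pointwise-++⁻ pl (trans lenl (sym (trans (length-availFrom (suc y) (drop 1 (postorder l))) (leaves-postorder⁻ l))))
                         (subst (ValidPtrs (pl ++ pr)) bounds ok)
  ... | okl , okr = subst (λ P → Walk x y P x' y') (sym reassoc)
        (from left (okl , from right (okr , (join-fits⁻ sl sr y≤x ,
          Walk-resp (sym (after-join⁻ x sl sr)) (sym (height-join y sl sr)) w))))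

walk-Dyck-iff : ∀ n t ps → length ps ≡ size t →
  HDecPath n (decorate (drop 1 (Path t)) ps) ⇔ (ValidPtrs ps (avail t) × size t ≡ n)
walk-Dyck-iff n t ps len = mk⇔
  (λ w → map₂ proj₁ (to from-origin (subst (λ P → Walk 0 0 P n n) (sym no-rest) w)))
  (λ (ok , eq) → subst (λ P → Walk 0 0 P n n) no-rest (from from-origin (ok , (eq , eq))))
  where
  from-origin : Walk 0 0 (decorate (drop 1 (Path t ++ [])) (ps ++ [])) n n
                ⇔ (ValidPtrs ps (avail t) × Walk (0 + size t) (0 + size t) [] n n)
  from-origin = walk-spine t 0 0 ps [] [] n n z≤n len
  no-rest : decorate (drop 1 (Path t ++ [])) (ps ++ []) ≡ decorate (drop 1 (Path t)) ps
  no-rest = cong₂ (λ ms → decorate (drop 1 ms)) (++-identityʳ (Path t)) (++-identityʳ ps)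

length-ptrs : (T : RelaxedTree) → length (ptrs T) ≡ size (spine T)
length-ptrs T = trans (Pointwise-length (valid T))
  (trans (length-availFrom 1 (drop 1 (postorder (spine T)))) (leaves-postorder⁻ (spine T)))

-- The decoder.

-- A stack item: a subtree read so far, its pointers, its tree B and the label
-- of its root (for a pointer leaf, the label of the pointer's target).
record Item : Set where
  constructor item
  field
    subtree  : Bin
    pointers : List ℕ
    btree    : Bin
    label    : ℕ
open Item

-- Decoder states: the stack (top first) and the environment [B(1), B(2), …].
State : Set
State = List Item × List Bin

-- The item created by a V step from the two topmost items i₂ (top) and i₁;
-- its root receives the next label.
join : Item → Item → List Bin → Item
join i₂ i₁ env = item (node (subtree i₁) (subtree i₂)) (pointers i₁ ++ pointers i₂)
                      (node (btree i₁) (btree i₂)) (suc (length env))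

step : State → Step → State
step (stk , env)           (H d) = item leaf [ d ] (at env d) d ∷ stk , env
step (i₂ ∷ i₁ ∷ stk , env) V     = join i₂ i₁ env ∷ stk , env ++ [ node (btree i₁) (btree i₂) ]
step ([] , env)            V     = [] , env
step (i ∷ [] , env)        V     = i ∷ [] , env

run : State → List Step → State
run st []       = st
run st (s ∷ ss) = run (step st s) ss

run-++ : ∀ st A B → run st (A ++ B) ≡ run (run st A) B
run-++ st []      B = refl
run-++ st (s ∷ A) B = run-++ (step st s) A B

-- The state before reading a Dyck path: the left-most leaf, labelled 1.
start : State
start = item leaf [] leaf 1 ∷ [] , leaf ∷ []

walkB-node : ∀ l r b env ps {bl e₁ ps₁ br e₂ ps₂} →
  walkB l b env ps ≡ (bl , e₁ , ps₁) → walkB r false e₁ ps₁ ≡ (br , e₂ , ps₂) →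
  walkB (node l r) b env ps ≡ (node bl br , e₂ ++ [ node bl br ] , ps₂)
walkB-node l r b env ps eql eqr rewrite eql | eqr = refl

-- Reading the decorated path of a full subtree t pushes a single item for t,
-- and the environment grows exactly as in the computation of Bs by walkB.
decode-subtree : ∀ t ps rest m stk env → length ps ≡ suc (size t) →
  Σ Bin λ B → Σ (List Bin) λ env' → Σ ℕ λ ℓ →
    (walkB t false env (ps ++ rest) ≡ (B , env' , rest)) ×
    (run (stk , env) (decorate (Path t ++ m) (ps ++ rest)) ≡ run (item t ps B ℓ ∷ stk , env') (decorate m rest))
decode-subtree leaf (p ∷ []) rest m stk env _ = at env p , env , p , refl , refl
decode-subtree (node l r) ps rest m stk env len
  with splitAtLength ps (suc (size l)) (suc (size r)) (trans len (cong suc (sym (+-suc (size l) (size r)))))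
... | pl , pr , refl , lenl , lenr
  with decode-subtree l pl (pr ++ rest) (Path r ++ v ∷ m) stk env lenl
... | Bl , e₁ , ℓl , walkl , runl
  with decode-subtree r pr rest (v ∷ m) (item l pl Bl ℓl ∷ stk) e₁ lenr
... | Br , e₂ , ℓr , walkr , runr =
  node Bl Br , e₂ ++ [ node Bl Br ] , suc (length e₂) ,
  trans (cong (walkB (node l r) false env) (++-assoc pl pr rest)) (walkB-node l r false env (pl ++ pr ++ rest) walkl walkr) ,
  trans (cong₂ (λ ms qs → run (stk , env) (decorate ms qs)) (path-join-++ (Path l) (Path r) [ v ] m) (++-assoc pl pr rest))
        (trans runl runr)

-- The same for a spine, whose left-most leaf is already on the stack.
decode-spine : ∀ t ps rest m stk env → length ps ≡ size t →
  Σ Bin λ B → Σ (List Bin) λ env' → Σ ℕ λ ℓ →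
    (walkB t true env (ps ++ rest) ≡ (B , env' , rest)) ×
    (run (item leaf [] leaf 1 ∷ stk , env ++ [ leaf ]) (decorate (drop 1 (Path t ++ m)) (ps ++ rest))
      ≡ run (item t ps B ℓ ∷ stk , env') (decorate m rest))
decode-spine leaf [] rest m stk env _ = leaf , env ++ [ leaf ] , 1 , refl , refl
decode-spine (node l r) ps rest m stk env len
  with splitAtLength ps (size l) (suc (size r)) (trans len (sym (+-suc (size l) (size r))))
... | pl , pr , refl , lenl , lenr
  with decode-spine l pl (pr ++ rest) (Path r ++ v ∷ m) stk env lenl
... | Bl , e₁ , ℓl , walkl , runl
  with decode-subtree r pr rest (v ∷ m) (item l pl Bl ℓl ∷ stk) e₁ lenr
... | Br , e₂ , ℓr , walkr , runr =
  node Bl Br , e₂ ++ [ node Bl Br ] , suc (length e₂) ,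
  trans (cong (walkB (node l r) true env) (++-assoc pl pr rest)) (walkB-node l r true env (pl ++ pr ++ rest) walkl walkr) ,
  trans (cong₂ (λ ms qs → run (item leaf [] leaf 1 ∷ stk , env ++ [ leaf ]) (decorate (drop 1 ms) qs))
               (path-join-++ (Path l) (Path r) [ v ] m) (++-assoc pl pr rest))
        (trans runl runr)

decode-Dyck : ∀ T → Σ Bin λ B → Σ ℕ λ ℓ →
  run start (Dyck T) ≡ (item (spine T) (ptrs T) B ℓ ∷ [] , Bs T)
decode-Dyck T with decode-spine (spine T) (ptrs T) [] [] [] [] (length-ptrs T)
... | B , _ , ℓ , walk , decoded
  rewrite ++-identityʳ (ptrs T) | ++-identityʳ (Path (spine T)) | walk = B , ℓ , decoded

-- Injectivity: the decoder recovers the spine and the pointers from Dyck T.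
Dyck-injective : ∀ T T′ → Dyck T ≡ Dyck T′ → (spine T ≡ spine T′) × (ptrs T ≡ ptrs T′)
Dyck-injective T T′ eq with decode-Dyck T | decode-Dyck T′
... | B , ℓ , decoded | B′ , ℓ′ , decoded′ = cong subtree top , cong pointers top
  where
  top : item (spine T) (ptrs T) B ℓ ≡ item (spine T′) (ptrs T′) B′ ℓ′
  top = proj₁ (∷-injective (cong proj₁ (trans (sym decoded) (trans (cong (run start) eq) decoded′))))

endX-++ : ∀ A B → endX (A ++ B) ≡ endX A + endX B
endX-++ []        B = refl
endX-++ (H _ ∷ A) B = cong suc (endX-++ A B)
endX-++ (V ∷ A)   B = endX-++ A B

endY-++ : ∀ A B → endY (A ++ B) ≡ endY A + endY B
endY-++ []        B = refl
endY-++ (H _ ∷ A) B = endY-++ A B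
endY-++ (V ∷ A)   B = cong suc (endY-++ A B)

endX-H : ∀ Q d → endX (Q ++ [ H d ]) ≡ suc (endX Q)
endX-H Q d = trans (endX-++ Q _) (+-one _)

endY-H : ∀ Q d → endY (Q ++ [ H d ]) ≡ endY Q
endY-H Q d = trans (endY-++ Q _) (+-identityʳ _)

endX-V : ∀ Q → endX (Q ++ [ V ]) ≡ endX Q
endX-V Q = trans (endX-++ Q _) (+-identityʳ _)

endY-V : ∀ Q → endY (Q ++ [ V ]) ≡ suc (endY Q)
endY-V Q = trans (endY-++ Q _) (+-one _)

annotate-++ : ∀ x y Q R → annotate x y (Q ++ R) ≡ annotate x y Q ++ annotate (x + endX Q) (y + endY Q) R
annotate-++ x y []        R = sym (cong₂ (λ a b → annotate a b R) (+-identityʳ x) (+-identityʳ y))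
annotate-++ x y (H d ∷ Q) R = cong ((suc x , y , d) ∷_) (trans (annotate-++ (suc x) y Q R)
  (cong (λ a → annotate (suc x) y Q ++ annotate a (y + endY Q) R) (sym (+-suc x (endX Q)))))
annotate-++ x y (V ∷ Q)   R = cong ((x , suc y , suc (suc y)) ∷_) (trans (annotate-++ x (suc y) Q R)
  (cong (λ a → annotate x (suc y) Q ++ annotate (x + endX Q) a R) (sym (+-suc y (endY Q)))))

lastOn : List Step → ℕ → ℕ
lastOn Q c = lastOnLine c 1 (annotate 0 0 Q)

lastStep : List Step → ℕ
lastStep Q = lastLabel 1 (annotate 0 0 Q)

lastOnLine-on : ∀ c d A x y l → x ≡ y + c → lastOnLine c d (A ++ [ (x , y , l) ]) ≡ l
lastOnLine-on c d [] x y l on with x ≟ y + c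
... | yes _  = refl
... | no off = ⊥-elim (off on)
lastOnLine-on c d ((x₀ , y₀ , l₀) ∷ A) x y l on with x₀ ≟ y₀ + c
... | yes _ = lastOnLine-on c l₀ A x y l on
... | no _  = lastOnLine-on c d A x y l on

lastOnLine-off : ∀ c d A x y l → ¬ (x ≡ y + c) → lastOnLine c d (A ++ [ (x , y , l) ]) ≡ lastOnLine c d A
lastOnLine-off c d [] x y l off with x ≟ y + c
... | yes on = ⊥-elim (off on)
... | no _   = refl
lastOnLine-off c d ((x₀ , y₀ , l₀) ∷ A) x y l off with x₀ ≟ y₀ + c
... | yes _ = lastOnLine-off c l₀ A x y l off
... | no _  = lastOnLine-off c d A x y l off

lastLabel-snoc : ∀ d A x y l → lastLabel d (A ++ [ (x , y , l) ]) ≡ l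
lastLabel-snoc d []                 x y l = refl
lastLabel-snoc d ((_ , _ , l₀) ∷ A) x y l = lastLabel-snoc l₀ A x y l

right-of-line : ∀ x y c → y + c < x → ¬ (x ≡ y + c)
right-of-line x y c lt on = <-irrefl (sym on) lt

length-snoc : ∀ {X : Set} (xs : List X) x → length (xs ++ [ x ]) ≡ suc (length xs)
length-snoc xs x = trans (length-++ xs) (+-one _)

at-++ : ∀ env env' j → 1 ≤ j → j ≤ length env → at (env ++ env') j ≡ at env j
at-++ (b ∷ env) env' (suc zero)    _ _         = refl
at-++ (b ∷ env) env' (suc (suc j)) _ (s≤s j≤) = at-++ env env' (suc j) (s≤s z≤n) j≤

at-last : ∀ env X → at (env ++ [ X ]) (suc (length env)) ≡ X
at-last []        X = refl
at-last (b ∷ env) X = at-last env X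

at-snoc-cases : ∀ env X j → 1 ≤ j → j ≤ length (env ++ [ X ]) →
  ((j ≤ length env) × (at (env ++ [ X ]) j ≡ at env j)) ⊎ ((j ≡ suc (length env)) × (at (env ++ [ X ]) j ≡ X))
at-snoc-cases env X j 1≤j j≤ with m≤n⇒m<n∨m≡n (subst (j ≤_) (length-snoc env X) j≤)
... | inj₁ (s≤s j<) = inj₁ (j< , at-++ env [ X ] j 1≤j j<)
... | inj₂ refl     = inj₂ (refl , at-last env X)

Labelled : List Bin → Item → Set
Labelled env i = (1 ≤ label i) × (label i ≤ length env) × (at env (label i) ≡ btree i)

Labelled-++ : ∀ env env' i → Labelled env i → Labelled (env ++ env') i
Labelled-++ env env' i (1≤ , ≤len , at≡) =
  1≤ , ≤-trans ≤len (subst (length env ≤_) (sym (length-++ env)) (m≤m+n _ _)) ,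
  trans (at-++ env env' (label i) 1≤ ≤len) at≡

-- The bottom item is a spine (its pointers omit the left-most leaf); every
-- other item is a full subtree, and a leaf item is a pointer leaf whose label
-- is its pointer.
StackShape : List Item → Set
StackShape []            = ⊥
StackShape (i ∷ [])      = length (pointers i) ≡ size (subtree i)
StackShape (i ∷ j ∷ stk) = (length (pointers i) ≡ suc (size (subtree i))
                            × (subtree i ≡ leaf → pointers i ≡ [ label i ]))
                           × StackShape (j ∷ stk)

spelled : List Item → List Step
spelled []            = []
spelled (i ∷ [])      = decorate (drop 1 (Path (subtree i))) (pointers i)
spelled (i ∷ j ∷ stk) = spelled (j ∷ stk) ++ decorate (Path (subtree i)) (pointers i)

labelAt : List Item → ℕ → ℕ
labelAt []      _       = 0
labelAt (i ∷ _) zero    = label i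
labelAt (_ ∷ s) (suc t) = labelAt s t

IsNode : Bin → Set
IsNode leaf       = ⊥
IsNode (node _ _) = ⊤

TopFresh SecondFresh : List Item → List Bin → Set
TopFresh []      env = ⊤
TopFresh (i ∷ _) env = IsNode (subtree i) → label i ≡ length env
SecondFresh (i₂ ∷ i₁ ∷ _) env = subtree i₂ ≡ leaf → IsNode (subtree i₁) → label i₁ ≡ length env
SecondFresh _             env = ⊤

-- The invariant of the decoder after reading a walk prefix Q: the stack has
-- depth + 1 items, Q ends on the diagonal x = y + depth, and the t-th item
-- from the top carries the label of the last step of Q on the diagonal
-- x = y + (depth ∸ t).
record DecoderInv (Q : List Step) (st : State) : Set where
  field
    depth        : ℕ
    stack-size   : length (proj₁ st) ≡ suc depth
    offset       : endX Q ≡ endY Q + depth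
    env-size     : length (proj₂ st) ≡ suc (endY Q)
    env-first    : at (proj₂ st) 1 ≡ leaf
    shape        : StackShape (proj₁ st)
    labelled     : All (Labelled (proj₂ st)) (proj₁ st)
    spells       : Q ≡ spelled (proj₁ st)
    diagonals    : ∀ t → t ≤ depth → lastOn Q (depth ∸ t) ≡ labelAt (proj₁ st) t
    last-step    : lastStep Q ≡ labelAt (proj₁ st) 0
    top-fresh    : TopFresh (proj₁ st) (proj₂ st)
    second-fresh : SecondFresh (proj₁ st) (proj₂ st)
open DecoderInv

start-inv : DecoderInv [] start
start-inv = record
  { depth = 0 ; stack-size = refl ; offset = refl ; env-size = refl ; env-first = refl
  ; shape = refl ; labelled = (s≤s z≤n , s≤s z≤n , refl) ∷ [] ; spells = refl
  ; diagonals = λ { zero _ → refl } ; last-step = refl ; top-fresh = λ () ; second-fresh = tt }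

-- A V step is only possible away from the diagonal, where the stack holds
-- at least two items.
two-items : ∀ {Q stk env} → DecoderInv Q (stk , env) → suc (endY Q) ≤ endX Q →
  Σ Item λ i₂ → Σ Item λ i₁ → Σ (List Item) λ s → stk ≡ i₂ ∷ i₁ ∷ s
two-items {stk = []}          I _ = ⊥-elim (shape I)
two-items {stk = i₂ ∷ i₁ ∷ s} I _ = i₂ , i₁ , s , refl
two-items {Q} {stk = i ∷ []}  I below with stack-size I | offset I
... | refl | on-diagonal = ⊥-elim (<-irrefl (sym (trans on-diagonal (+-identityʳ _))) below)

offset-two : ∀ {Q i₂ i₁ s env} (I : DecoderInv Q (i₂ ∷ i₁ ∷ s , env)) →
  endX Q ≡ suc (endY Q) + length s
offset-two {Q} {s = s} I = trans (offset I) (trans (cong (endY Q +_) (sym (suc-injective (stack-size I)))) (+-suc _ _))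

-- An H step pushes a pointer leaf, which lands on the next diagonal.
read-H : ∀ Q stk env d → DecoderInv Q (stk , env) → 1 ≤ d → d ≤ suc (endY Q) →
  DecoderInv (Q ++ [ H d ]) (step (stk , env) (H d))
read-H Q []      env d I _   _   = ⊥-elim (shape I)
read-H Q (j ∷ s) env d I 1≤d d≤ = record
  { depth        = suc K
  ; stack-size   = cong suc (stack-size I)
  ; offset       = trans (endX-H Q d) (trans (cong suc (offset I))
                     (sym (trans (cong (_+ suc K) (endY-H Q d)) (+-suc _ _))))
  ; env-size     = trans (env-size I) (cong suc (sym (endY-H Q d)))
  ; env-first    = env-first I
  ; shape        = (refl , λ _ → refl) , shape I
  ; labelled     = (1≤d , subst (d ≤_) (sym (env-size I)) d≤ , refl) ∷ labelled I
  ; spells       = cong (_++ [ H d ]) (spells I)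
  ; diagonals    = diagonals′
  ; last-step    = trans (cong (lastLabel 1) (annotate-++ 0 0 Q [ H d ])) (lastLabel-snoc 1 (annotate 0 0 Q) _ _ d)
  ; top-fresh    = λ ()
  ; second-fresh = λ _ → top-fresh I
  }
  where
  K : ℕ
  K = depth I
  diagonals′ : ∀ t → t ≤ suc K → lastOn (Q ++ [ H d ]) (suc K ∸ t) ≡ labelAt (item leaf [ d ] (at env d) d ∷ j ∷ s) t
  diagonals′ zero _ = trans (cong (lastOnLine (suc K) 1) (annotate-++ 0 0 Q [ H d ]))
    (lastOnLine-on (suc K) 1 (annotate 0 0 Q) _ _ d (trans (cong suc (offset I)) (sym (+-suc _ _))))
  diagonals′ (suc t) t≤ = trans (cong (lastOnLine (K ∸ t) 1) (annotate-++ 0 0 Q [ H d ]))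
    (trans (lastOnLine-off (K ∸ t) 1 (annotate 0 0 Q) _ _ d
              (right-of-line (suc (endX Q)) (endY Q) (K ∸ t)
                (s≤s (subst (endY Q + (K ∸ t) ≤_) (sym (offset I)) (+-monoʳ-≤ (endY Q) (m∸n≤m K t))))))
           (diagonals I t (≤-pred t≤)))

join-shape : ∀ i₂ i₁ s env → StackShape (i₂ ∷ i₁ ∷ s) → StackShape (join i₂ i₁ env ∷ s)
join-shape i₂ i₁ []      env ((len₂ , _) , len₁) =
  trans (length-++ (pointers i₁)) (trans (cong₂ _+_ len₁ len₂) (+-suc _ _))
join-shape i₂ i₁ (j ∷ s) env ((len₂ , _) , (len₁ , _) , sh) =
  (trans (length-++ (pointers i₁)) (trans (cong₂ _+_ len₁ len₂) (cong suc (+-suc _ _))) , λ ()) , sh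

join-spelled : ∀ i₂ i₁ s env → StackShape (i₂ ∷ i₁ ∷ s) →
  spelled (i₂ ∷ i₁ ∷ s) ++ [ V ] ≡ spelled (join i₂ i₁ env ∷ s)
join-spelled (item t₂ p₂ _ _) (item t₁ p₁ _ _) [] env ((len₂ , _) , len₁) = begin
  (decorate (drop 1 (Path t₁)) p₁ ++ decorate (Path t₂) p₂) ++ [ V ]
    ≡⟨ ++-assoc (decorate (drop 1 (Path t₁)) p₁) _ _ ⟩
  decorate (drop 1 (Path t₁)) p₁ ++ decorate (Path t₂) p₂ ++ [ V ]
    ≡⟨ decorate-join (drop 1 (Path t₁)) t₂ p₁ p₂ (trans len₁ (sym (hMoves-Path⁻ t₁))) len₂ ⟨
  decorate (drop 1 (Path t₁) ++ Path t₂ ++ [ v ]) (p₁ ++ p₂)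
    ≡⟨ cong (λ ms → decorate ms (p₁ ++ p₂)) (drop1-Path-++ t₁ (Path t₂ ++ [ v ])) ⟨
  decorate (drop 1 (Path (node t₁ t₂))) (p₁ ++ p₂) ∎
  where open ≡-Reasoning
join-spelled (item t₂ p₂ _ _) (item t₁ p₁ _ _) (j ∷ s) env ((len₂ , _) , (len₁ , _) , _) = begin
  ((spelled (j ∷ s) ++ decorate (Path t₁) p₁) ++ decorate (Path t₂) p₂) ++ [ V ]
    ≡⟨ trans (++-assoc (spelled (j ∷ s) ++ _) _ _) (++-assoc (spelled (j ∷ s)) _ _) ⟩
  spelled (j ∷ s) ++ decorate (Path t₁) p₁ ++ decorate (Path t₂) p₂ ++ [ V ]
    ≡⟨ cong (spelled (j ∷ s) ++_) (decorate-join (Path t₁) t₂ p₁ p₂ (trans len₁ (sym (hMoves-Path t₁))) len₂) ⟨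
  spelled (j ∷ s) ++ decorate (Path (node t₁ t₂)) (p₁ ++ p₂) ∎
  where open ≡-Reasoning

join-second-fresh : ∀ i₂ i₁ s env env' → SecondFresh (join i₂ i₁ env ∷ s) env'
join-second-fresh i₂ i₁ []      env env' = tt
join-second-fresh i₂ i₁ (j ∷ s) env env' = λ ()

-- A V step joins the two topmost items into a new node labelled by the next
-- label; the new node lies on the diagonal of the item below them.
read-V : ∀ Q stk env → DecoderInv Q (stk , env) → suc (endY Q) ≤ endX Q →
  DecoderInv (Q ++ [ V ]) (step (stk , env) V)
read-V Q stk env I below with two-items I below
... | i₂ , i₁ , s , refl = record
  { depth        = length s
  ; stack-size   = refl
  ; offset       = trans (endX-V Q) (trans (offset-two I) (cong (_+ length s) (sym (endY-V Q))))
  ; env-size     = trans (length-snoc env X) (cong suc (trans (env-size I) (sym (endY-V Q))))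
  ; env-first    = trans (at-++ env [ X ] 1 (s≤s z≤n) (subst (1 ≤_) (sym (env-size I)) (s≤s z≤n))) (env-first I)
  ; shape        = join-shape i₂ i₁ s env (shape I)
  ; labelled     = labelled′ (labelled I)
  ; spells       = trans (cong (_++ [ V ]) (spells I)) (join-spelled i₂ i₁ s env (shape I))
  ; diagonals    = diagonals′
  ; last-step    = trans (cong (lastLabel 1) (annotate-++ 0 0 Q [ V ]))
                     (trans (lastLabel-snoc 1 (annotate 0 0 Q) _ _ _) (cong suc (sym (env-size I))))
  ; top-fresh    = λ _ → sym (length-snoc env X)
  ; second-fresh = join-second-fresh i₂ i₁ s env (env ++ [ X ])
  }
  where
  X : Bin
  X = node (btree i₁) (btree i₂)
  depth-eq : depth I ≡ suc (length s)
  depth-eq = sym (suc-injective (stack-size I))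
  labelled′ : All (Labelled env) (i₂ ∷ i₁ ∷ s) → All (Labelled (env ++ [ X ])) (join i₂ i₁ env ∷ s)
  labelled′ (_ ∷ _ ∷ ok) = (s≤s z≤n , ≤-reflexive (sym (length-snoc env X)) , at-last env X)
                          ∷ All.map (λ {i} → Labelled-++ env [ X ] i) ok
  diagonals′ : ∀ t → t ≤ length s → lastOn (Q ++ [ V ]) (length s ∸ t) ≡ labelAt (join i₂ i₁ env ∷ s) t
  diagonals′ zero _ = trans (cong (lastOnLine (length s) 1) (annotate-++ 0 0 Q [ V ]))
    (trans (lastOnLine-on (length s) 1 (annotate 0 0 Q) _ _ _ (offset-two I)) (cong suc (sym (env-size I))))
  diagonals′ (suc t) t≤ = trans (cong (lastOnLine (length s ∸ suc t) 1) (annotate-++ 0 0 Q [ V ]))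
    (trans (lastOnLine-off _ 1 (annotate 0 0 Q) _ _ _
              (right-of-line (endX Q) (suc (endY Q)) (length s ∸ suc t)
                (subst (suc (endY Q) + (length s ∸ suc t) <_) (sym (offset-two I))
                  (+-monoʳ-< (suc (endY Q)) (∸-monoʳ-< {o = 0} (s≤s z≤n) t≤)))))
      (trans (cong (λ k → lastOn Q (k ∸ suc (suc t))) (sym depth-eq))
             (diagonals I (suc (suc t)) (subst (suc (suc t) ≤_) (sym depth-eq) (s≤s t≤)))))

vPair-stack : ∀ Q i₂ i₁ s env → DecoderInv Q (i₂ ∷ i₁ ∷ s , env) → vPair Q ≡ (label i₁ , label i₂)
vPair-stack Q i₂ i₁ s env I = cong₂ _,_ v₁-eq (last-step I)
  where
  depth-eq : depth I ≡ suc (length s)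
  depth-eq = sym (suc-injective (stack-size I))
  line-eq : endX Q ∸ suc (endY Q) ≡ depth I ∸ 1
  line-eq = trans (cong (_∸ suc (endY Q)) (offset-two I))
                  (trans (m+n∸m≡n (suc (endY Q)) _) (cong (_∸ 1) (sym depth-eq)))
  v₁-eq : lastOn Q (endX Q ∸ suc (endY Q)) ≡ label i₁
  v₁-eq = trans (cong (lastOn Q) line-eq) (diagonals I 1 (subst (1 ≤_) (sym depth-eq) (s≤s z≤n)))

decoder-invariant : ∀ S Q st x' y' → DecoderInv Q st → Walk (endX Q) (endY Q) S x' y' →
  DecoderInv (Q ++ S) (run st S)
decoder-invariant [] Q st x' y' I _ = subst (λ P → DecoderInv P st) (sym (++-identityʳ Q)) I
decoder-invariant (H d ∷ S) Q (stk , env) x' y' I ((1≤d , d≤) , w) =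
  subst (λ P → DecoderInv P (run (step (stk , env) (H d)) S)) (++-assoc Q [ H d ] S)
    (decoder-invariant S (Q ++ [ H d ]) _ x' y' (read-H Q stk env d I 1≤d d≤)
      (Walk-resp (sym (endX-H Q d)) (sym (endY-H Q d)) w))
decoder-invariant (V ∷ S) Q (stk , env) x' y' I (below , w) =
  subst (λ P → DecoderInv P (run (step (stk , env) V) S)) (++-assoc Q [ V ] S)
    (decoder-invariant S (Q ++ [ V ]) _ x' y' (read-V Q stk env I below)
      (Walk-resp (sym (endX-V Q)) (sym (endY-V Q)) w))

-- Compacted trees give C-decorated paths.

walk-prefix : ∀ A B x y x' y' → Walk x y (A ++ B) x' y' → Walk x y A (x + endX A) (y + endY A)
walk-prefix []        B x y x' y' w = sym (+-identityʳ x) , sym (+-identityʳ y)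
walk-prefix (H d ∷ A) B x y x' y' (ok , w) =
  ok , subst (λ z → Walk (suc x) y A z (y + endY A)) (sym (+-suc x (endX A))) (walk-prefix A B (suc x) y x' y' w)
walk-prefix (V ∷ A)   B x y x' y' (ok , w) =
  ok , subst (λ z → Walk x (suc y) A (x + endX A) z) (sym (+-suc y (endY A))) (walk-prefix A B x (suc y) x' y' w)

walk-suffix : ∀ A B x y x' y' → Walk x y (A ++ B) x' y' → Walk (x + endX A) (y + endY A) B x' y'
walk-suffix []        B x y x' y' w       = Walk-resp (sym (+-identityʳ x)) (sym (+-identityʳ y)) w
walk-suffix (H d ∷ A) B x y x' y' (_ , w) = Walk-resp (sym (+-suc x (endX A))) refl (walk-suffix A B (suc x) y x' y' w)
walk-suffix (V ∷ A)   B x y x' y' (_ , w) = Walk-resp refl (sym (+-suc y (endY A))) (walk-suffix A B x (suc y) x' y' w)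

env-grows : ∀ st S → Σ (List Bin) λ F → proj₂ (run st S) ≡ proj₂ st ++ F
env-grows st                      []        = [] , sym (++-identityʳ _)
env-grows (stk , env)             (H d ∷ S) = env-grows _ S
env-grows ([] , env)              (V ∷ S)   = env-grows _ S
env-grows (i ∷ [] , env)          (V ∷ S)   = env-grows _ S
env-grows (i₂ ∷ i₁ ∷ stk , env)   (V ∷ S) with env-grows _ S
... | F , eq = _ ∷ F , trans eq (++-assoc env _ F)

not-unique-repeat : ∀ {Y : Set} (A : List Y) X B C → ¬ Unique (A ++ X ∷ B ++ X ∷ C)
not-unique-repeat []      X B C (X∉ ∷ _) = differs-from-all B X∉
  where
  differs-from-all : ∀ B → ¬ All (λ Z → ¬ X ≡ Z) (B ++ X ∷ C)
  differs-from-all []      (X≢X ∷ _) = X≢X refl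
  differs-from-all (_ ∷ B) (_ ∷ ne)  = differs-from-all B ne
not-unique-repeat (_ ∷ A) X B C (_ ∷ u) = not-unique-repeat A X B C u

pointer-tree : ∀ env F i d → Labelled env i → d ≡ label i → at (env ++ F) d ≡ btree i
pointer-tree env F i d (1≤ , ≤len , at≡) refl = trans (at-++ env F (label i) 1≤ ≤len) at≡

-- If H h₁ H h₂ V occurs after a V step whose pair is (h₁ , h₂), it rebuilds
-- the node built by that V step.
repeated-join : ∀ Q i₂ i₁ s env R h₁ h₂ post → DecoderInv Q (i₂ ∷ i₁ ∷ s , env) →
  h₁ ≡ label i₁ → h₂ ≡ label i₂ →
  Σ (List Bin) λ F → Σ (List Bin) λ G →
    proj₂ (run (i₂ ∷ i₁ ∷ s , env) (V ∷ R ++ H h₁ ∷ H h₂ ∷ V ∷ post))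
      ≡ env ++ node (btree i₁) (btree i₂) ∷ F ++ node (btree i₁) (btree i₂) ∷ G
repeated-join Q i₂ i₁ s env R h₁ h₂ post I h₁≡ h₂≡ = F , G , (begin
  proj₂ (run after-V (R ++ H h₁ ∷ H h₂ ∷ V ∷ post))
    ≡⟨ cong proj₂ (run-++ after-V R _) ⟩
  proj₂ (run after-HHV post)
    ≡⟨ G-eq ⟩
  (proj₂ after-R ++ [ node (at (proj₂ after-R) h₁) (at (proj₂ after-R) h₂) ]) ++ G
    ≡⟨ cong (λ e → (e ++ [ node (at e h₁) (at e h₂) ]) ++ G) F-eq ⟩
  ((env ++ X ∷ F) ++ [ node (at (env ++ X ∷ F) h₁) (at (env ++ X ∷ F) h₂) ]) ++ G
    ≡⟨ cong (λ Y → ((env ++ X ∷ F) ++ [ Y ]) ++ G) (cong₂ node (pointer-tree env (X ∷ F) i₁ h₁ ok₁ h₁≡)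
                                                             (pointer-tree env (X ∷ F) i₂ h₂ ok₂ h₂≡)) ⟩
  ((env ++ X ∷ F) ++ [ X ]) ++ G
    ≡⟨ trans (++-assoc (env ++ X ∷ F) [ X ] G) (++-assoc env (X ∷ F) (X ∷ G)) ⟩
  env ++ X ∷ F ++ X ∷ G ∎)
  where
  open ≡-Reasoning
  X : Bin
  X = node (btree i₁) (btree i₂)
  ok₂ : Labelled env i₂
  ok₂ = All.head (labelled I)
  ok₁ : Labelled env i₁
  ok₁ = All.head (All.tail (labelled I))
  after-V after-R after-HHV : State
  after-V = step (i₂ ∷ i₁ ∷ s , env) V
  after-R = run after-V R
  after-HHV = run after-R (H h₁ ∷ H h₂ ∷ V ∷ [])
  F G : List Bin
  F = proj₁ (env-grows after-V R)
  G = proj₁ (env-grows after-HHV post)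
  F-eq : proj₂ after-R ≡ env ++ X ∷ F
  F-eq = trans (proj₂ (env-grows after-V R)) (++-assoc env [ X ] F)
  G-eq : proj₂ (run after-HHV post)
       ≡ (proj₂ after-R ++ [ node (at (proj₂ after-R) h₁) (at (proj₂ after-R) h₂) ]) ++ G
  G-eq = proj₂ (env-grows after-HHV post)

forbidden-pattern-repeats : ∀ Q R h₁ h₂ post x' y' → Walk 0 0 (Q ++ V ∷ R ++ H h₁ ∷ H h₂ ∷ V ∷ post) x' y' →
  h₁ ≡ proj₁ (vPair Q) → h₂ ≡ proj₂ (vPair Q) →
  ¬ Unique (proj₂ (run start (Q ++ V ∷ R ++ H h₁ ∷ H h₂ ∷ V ∷ post)))
forbidden-pattern-repeats Q R h₁ h₂ post x' y' walk h₁≡ h₂≡ unique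
  with run start Q
     | decoder-invariant Q [] start _ _ start-inv (walk-prefix Q (V ∷ R ++ H h₁ ∷ H h₂ ∷ V ∷ post) 0 0 x' y' walk)
     | run-++ start Q (V ∷ R ++ H h₁ ∷ H h₂ ∷ V ∷ post)
... | stk , env | I | run≡ with two-items I (proj₁ (walk-suffix Q (V ∷ R ++ H h₁ ∷ H h₂ ∷ V ∷ post) 0 0 x' y' walk))
... | i₂ , i₁ , s , refl
  with repeated-join Q i₂ i₁ s env R h₁ h₂ post I
         (trans h₁≡ (cong proj₁ (vPair-stack Q i₂ i₁ s env I))) (trans h₂≡ (cong proj₂ (vPair-stack Q i₂ i₁ s env I)))
... | F , G , env≡ = not-unique-repeat env _ F G (subst Unique (trans (cong proj₂ run≡) env≡) unique)

Bs-decoded : ∀ T → Bs T ≡ proj₂ (run start (Dyck T))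
Bs-decoded T = sym (cong proj₂ (proj₂ (proj₂ (decode-Dyck T))))

Dyck-walk : ∀ n T → HasSize n T → HDecPath n (Dyck T)
Dyck-walk n T hasSize = from (walk-Dyck-iff n (spine T) (ptrs T) (length-ptrs T)) (valid T , hasSize)

-- The C-condition for Dyck T of a compacted tree T, whose decoder
-- environment Bs T has no repetition.
Dyck-CCondition : ∀ n T → HasSize n T → Compacted T → CCondition (Dyck T)
Dyck-CCondition n T hasSize compacted pre post h₁ h₂ P≡ Q R pre≡ (h₁≡ , h₂≡) =
  forbidden-pattern-repeats Q R h₁ h₂ post n n (subst (λ P → Walk 0 0 P n n) path≡ (Dyck-walk n T hasSize)) h₁≡ h₂≡
    (subst Unique (trans (Bs-decoded T) (cong (λ P → proj₂ (run start P)) path≡)) compacted)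
  where
  path≡ : Dyck T ≡ Q ++ V ∷ R ++ H h₁ ∷ H h₂ ∷ V ∷ post
  path≡ = trans P≡ (trans (cong (_++ H h₁ ∷ H h₂ ∷ V ∷ post) pre≡) (++-assoc Q (V ∷ R) _))

-- C-decorated paths decode to compacted trees.

LabelsInjective : List Bin → Set
LabelsInjective env =
  ∀ a b → 1 ≤ a → a ≤ length env → 1 ≤ b → b ≤ length env → at env a ≡ at env b → a ≡ b

LabelsInjective-snoc : ∀ env X → LabelsInjective env → (∀ j → 1 ≤ j → j ≤ length env → ¬ (at env j ≡ X)) →
  LabelsInjective (env ++ [ X ])
LabelsInjective-snoc env X inj fresh a b 1≤a a≤ 1≤b b≤ eq
  with at-snoc-cases env X a 1≤a a≤ | at-snoc-cases env X b 1≤b b≤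
... | inj₁ (a≤′ , at-a) | inj₁ (b≤′ , at-b) = inj a b 1≤a a≤′ 1≤b b≤′ (trans (sym at-a) (trans eq at-b))
... | inj₁ (a≤′ , at-a) | inj₂ (refl , at-b) = ⊥-elim (fresh a 1≤a a≤′ (trans (sym at-a) (trans eq at-b)))
... | inj₂ (refl , at-a) | inj₁ (b≤′ , at-b) = ⊥-elim (fresh b 1≤b b≤′ (trans (sym at-b) (trans (sym eq) at-a)))
... | inj₂ (refl , _)    | inj₂ (refl , _)    = refl

LabelsInjective⇒Unique : ∀ env → LabelsInjective env → Unique env
LabelsInjective⇒Unique []        _   = []
LabelsInjective⇒Unique (x ∷ env) inj = head-fresh env first-alone ∷
  LabelsInjective⇒Unique env (λ { (suc a) (suc b) _ a≤ _ b≤ eq →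
    suc-injective (inj (suc (suc a)) (suc (suc b)) (s≤s z≤n) (s≤s a≤) (s≤s z≤n) (s≤s b≤) eq) })
  where
  first-alone : ∀ a → 1 ≤ a → a ≤ length env → ¬ (x ≡ at env a)
  first-alone (suc a) _ a≤ eq = 1+n≢0 (suc-injective (sym (inj 1 (suc (suc a)) (s≤s z≤n) (s≤s z≤n) (s≤s z≤n) (s≤s a≤) eq)))
  head-fresh : ∀ env′ → (∀ a → 1 ≤ a → a ≤ length env′ → ¬ (x ≡ at env′ a)) → All (λ y → ¬ (x ≡ y)) env′
  head-fresh []         _     = []
  head-fresh (y ∷ env′) fresh = fresh 1 (s≤s z≤n) (s≤s z≤n) ∷
    head-fresh env′ (λ { (suc a) _ a≤ → fresh (suc (suc a)) (s≤s z≤n) (s≤s a≤) })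

record BuiltBy (Q : List Step) (env : List Bin) (j : ℕ) : Set where
  constructor built
  field
    before after : List Step
    splits       : Q ≡ before ++ V ∷ after
    a b          : ℕ
    pair         : vPair before ≡ (a , b)
    1≤a          : 1 ≤ a
    a<j          : a < j
    1≤b          : 1 ≤ b
    b<j          : b < j
    tree         : at env j ≡ node (at env a) (at env b)

History : List Step → List Bin → Set
History Q env = ∀ j → 2 ≤ j → j ≤ length env → BuiltBy Q env j

history-H : ∀ Q env d → History Q env → History (Q ++ [ H d ]) env
history-H Q env d hist j 2≤j j≤ with hist j 2≤j j≤
... | built Q′ R splits a b pair 1≤a a<j 1≤b b<j tree =
  built Q′ (R ++ [ H d ]) (trans (cong (_++ [ H d ]) splits) (++-assoc Q′ (V ∷ R) [ H d ])) a b pair 1≤a a<j 1≤b b<j tree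

history-V : ∀ Q i₂ i₁ s env → DecoderInv Q (i₂ ∷ i₁ ∷ s , env) → History Q env →
  History (Q ++ [ V ]) (env ++ [ node (btree i₁) (btree i₂) ])
history-V Q i₂ i₁ s env I hist j 2≤j j≤ with at-snoc-cases env (node (btree i₁) (btree i₂)) j (≤-trans (s≤s z≤n) 2≤j) j≤
... | inj₁ (j≤′ , at-j) with hist j 2≤j j≤′
...   | built Q′ R splits a b pair 1≤a a<j 1≤b b<j tree =
  built Q′ (R ++ [ V ]) (trans (cong (_++ [ V ]) splits) (++-assoc Q′ (V ∷ R) [ V ])) a b pair 1≤a a<j 1≤b b<j
    (trans at-j (trans tree (sym (cong₂ node (at-++ env [ X ] a 1≤a (≤-trans (<⇒≤ a<j) j≤′))
                                             (at-++ env [ X ] b 1≤b (≤-trans (<⇒≤ b<j) j≤′))))))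
  where X = node (btree i₁) (btree i₂)
history-V Q i₂ i₁ s env I hist j 2≤j j≤ | inj₂ (refl , at-j) =
  built Q [] refl (label i₁) (label i₂) (vPair-stack Q i₂ i₁ s env I)
    (proj₁ ok₁) (s≤s (proj₁ (proj₂ ok₁))) (proj₁ ok₂) (s≤s (proj₁ (proj₂ ok₂)))
    (trans at-j (sym (cong₂ node (old-tree i₁ ok₁) (old-tree i₂ ok₂))))
  where
  X : Bin
  X = node (btree i₁) (btree i₂)
  ok₂ : Labelled env i₂
  ok₂ = All.head (labelled I)
  ok₁ : Labelled env i₁
  ok₁ = All.head (All.tail (labelled I))
  old-tree : ∀ i → Labelled env i → at (env ++ [ X ]) (label i) ≡ btree i
  old-tree i (1≤ , ≤len , at≡) = trans (at-++ env [ X ] _ 1≤ ≤len) at≡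

V-in-init : ∀ (xs ys R′ : List Step) x → ¬ (x ≡ V) → xs ++ V ∷ R′ ≡ ys ++ [ x ] →
  Σ (List Step) λ R → ys ≡ xs ++ V ∷ R
V-in-init []       []       R′ x x≢V eq = ⊥-elim (x≢V (sym (proj₁ (∷-injective eq))))
V-in-init []       (y ∷ ys) R′ x x≢V eq with ∷-injective eq
... | refl , _ = ys , refl
V-in-init (z ∷ xs) []       R′ x x≢V eq = ⊥-elim (nonempty xs (proj₂ (∷-injective eq)))
  where
  nonempty : ∀ xs → ¬ (xs ++ V ∷ R′ ≡ [])
  nonempty []      ()
  nonempty (_ ∷ _) ()
V-in-init (z ∷ xs) (y ∷ ys) R′ x x≢V eq with ∷-injective eq
... | refl , eq′ with V-in-init xs ys R′ x x≢V eq′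
... | R , ys≡ = R , cong (z ∷_) ys≡

H≢V : ∀ {d} → ¬ (H d ≡ V)
H≢V ()

endY-pointer-leaf : ∀ ps → endY (decorate (h ∷ []) ps) ≡ 0
endY-pointer-leaf []      = refl
endY-pointer-leaf (_ ∷ _) = refl

-- On a C-decorated path, the V step after Q cannot rebuild a node j ≥ 2
-- that was built from the same labels by an earlier V step after Q′: if
-- one of the two joined items is an internal node it is newer than j, and
-- if both are pointer leaves then Q ends with H ℓ₁ H ℓ₂, a forbidden pattern.
no-rebuild : ∀ Q t₂ p₂ b₂ ℓ₂ t₁ p₁ b₁ ℓ₁ s env P S j Q′ R →
  DecoderInv Q (item t₂ p₂ b₂ ℓ₂ ∷ item t₁ p₁ b₁ ℓ₁ ∷ s , env) → CCondition P → P ≡ Q ++ V ∷ S →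
  2 ≤ j → j ≤ length env → Q ≡ Q′ ++ V ∷ R → vPair Q′ ≡ (ℓ₁ , ℓ₂) → ℓ₁ < j → ℓ₂ < j → ⊥
no-rebuild Q (node _ _) p₂ b₂ ℓ₂ t₁ p₁ b₁ ℓ₁ s env P S j Q′ R I _ _ _ j≤ _ _ _ ℓ₂<j =
  <-irrefl refl (≤-trans ℓ₂<j (subst (j ≤_) (sym (top-fresh I tt)) j≤))
no-rebuild Q leaf p₂ b₂ ℓ₂ (node _ _) p₁ b₁ ℓ₁ s env P S j Q′ R I _ _ _ j≤ _ _ ℓ₁<j _ =
  <-irrefl refl (≤-trans ℓ₁<j (subst (j ≤_) (sym (second-fresh I refl tt)) j≤))
no-rebuild Q leaf p₂ b₂ ℓ₂ leaf p₁ b₁ ℓ₁ [] env P S j Q′ R I _ _ 2≤j j≤ _ _ _ _ =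
  <-irrefl refl (≤-trans 2≤j (subst (j ≤_) (trans (env-size I) (cong suc (trans (cong endY (spells I)) (endY-pointer-leaf p₂)))) j≤))
no-rebuild Q leaf p₂ b₂ ℓ₂ leaf p₁ b₁ ℓ₁ (i₀ ∷ s) env P S j Q′ R I ccond P≡ _ _ Q≡ pair _ _
  with shape I
... | (_ , leaf₂) , (_ , leaf₁) , _ with leaf₂ refl | leaf₁ refl
... | refl | refl = ccond pre S ℓ₁ ℓ₂ P≡′ Q′ R₂ pre≡ (cong proj₁ (sym pair) , cong proj₂ (sym pair))
  where
  pre : List Step
  pre = spelled (i₀ ∷ s)
  P≡′ : P ≡ pre ++ H ℓ₁ ∷ H ℓ₂ ∷ V ∷ S
  P≡′ = trans P≡ (trans (cong (_++ V ∷ S) (spells I))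
          (trans (++-assoc (pre ++ [ H ℓ₁ ]) [ H ℓ₂ ] (V ∷ S)) (++-assoc pre [ H ℓ₁ ] (H ℓ₂ ∷ V ∷ S))))
  drop-H₂ : Σ (List Step) λ R₁ → pre ++ [ H ℓ₁ ] ≡ Q′ ++ V ∷ R₁
  drop-H₂ = V-in-init Q′ (pre ++ [ H ℓ₁ ]) R (H ℓ₂) H≢V (trans (sym Q≡) (spells I))
  drop-H₁ : Σ (List Step) λ R₂ → pre ≡ Q′ ++ V ∷ R₂
  drop-H₁ = V-in-init Q′ pre (proj₁ drop-H₂) (H ℓ₁) H≢V (sym (proj₂ drop-H₂))
  R₂ : List Step
  R₂ = proj₁ drop-H₁
  pre≡ : pre ≡ Q′ ++ V ∷ R₂
  pre≡ = proj₂ drop-H₁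

node-injective : ∀ {a b c d} → node a b ≡ node c d → (a ≡ c) × (b ≡ d)
node-injective refl = refl , refl

new-node-fresh : ∀ Q i₂ i₁ s env P S → DecoderInv Q (i₂ ∷ i₁ ∷ s , env) → LabelsInjective env → History Q env →
  CCondition P → P ≡ Q ++ V ∷ S → ∀ j → 1 ≤ j → j ≤ length env → ¬ (at env j ≡ node (btree i₁) (btree i₂))
new-node-fresh Q i₂ i₁ s env P S I inj hist ccond P≡ (suc zero) _ _ eq with trans (sym (env-first I)) eq
... | ()
new-node-fresh Q i₂@(item t₂ p₂ b₂ ℓ₂) i₁@(item t₁ p₁ b₁ ℓ₁) s env P S I inj hist ccond P≡ (suc (suc j)) _ j≤ eq
  with hist (suc (suc j)) (s≤s (s≤s z≤n)) j≤
... | built Q′ R Q≡ a b pair 1≤a a<j 1≤b b<j tree =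
  no-rebuild Q t₂ p₂ b₂ ℓ₂ t₁ p₁ b₁ ℓ₁ s env P S (suc (suc j)) Q′ R I ccond P≡ (s≤s (s≤s z≤n)) j≤ Q≡
    (trans pair (cong₂ _,_ a≡ b≡)) (subst (_< suc (suc j)) a≡ a<j) (subst (_< suc (suc j)) b≡ b<j)
  where
  ok₂ : Labelled env i₂
  ok₂ = All.head (labelled I)
  ok₁ : Labelled env i₁
  ok₁ = All.head (All.tail (labelled I))
  same-children : (at env a ≡ btree i₁) × (at env b ≡ btree i₂)
  same-children = node-injective (trans (sym tree) eq)
  a≡ : a ≡ ℓ₁
  a≡ = inj a ℓ₁ 1≤a (≤-trans (<⇒≤ a<j) j≤) (proj₁ ok₁) (proj₁ (proj₂ ok₁))
         (trans (proj₁ same-children) (sym (proj₂ (proj₂ ok₁))))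
  b≡ : b ≡ ℓ₂
  b≡ = inj b ℓ₂ 1≤b (≤-trans (<⇒≤ b<j) j≤) (proj₁ ok₂) (proj₁ (proj₂ ok₂))
         (trans (proj₂ same-children) (sym (proj₂ (proj₂ ok₂))))

labels-stay-injective : ∀ S Q st P x' y' → DecoderInv Q st → LabelsInjective (proj₂ st) → History Q (proj₂ st) →
  CCondition P → P ≡ Q ++ S → Walk (endX Q) (endY Q) S x' y' → LabelsInjective (proj₂ (run st S))
labels-stay-injective [] Q st P x' y' I inj hist ccond P≡ w = inj
labels-stay-injective (H d ∷ S) Q (stk , env) P x' y' I inj hist ccond P≡ ((1≤d , d≤) , w) =
  labels-stay-injective S (Q ++ [ H d ]) _ P x' y' (read-H Q stk env d I 1≤d d≤) inj (history-H Q env d hist) ccond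
    (trans P≡ (sym (++-assoc Q [ H d ] S))) (Walk-resp (sym (endX-H Q d)) (sym (endY-H Q d)) w)
labels-stay-injective (V ∷ S) Q (stk , env) P x' y' I inj hist ccond P≡ (below , w) with two-items I below
... | i₂ , i₁ , s , refl =
  labels-stay-injective S (Q ++ [ V ]) _ P x' y' (read-V Q _ env I below)
    (LabelsInjective-snoc env _ inj (new-node-fresh Q i₂ i₁ s env P S I inj hist ccond P≡))
    (history-V Q i₂ i₁ s env I hist) ccond
    (trans P≡ (sym (++-assoc Q [ V ] S))) (Walk-resp (sym (endX-V Q)) (sym (endY-V Q)) w)

start-injective : LabelsInjective (leaf ∷ [])
start-injective (suc zero)    (suc zero)    _ _         _ _         _ = refl
start-injective (suc (suc _)) _             _ (s≤s ()) _ _         _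
start-injective (suc zero)    (suc (suc _)) _ _         _ (s≤s ()) _

start-history : History [] (leaf ∷ [])
start-history (suc zero)    (s≤s ()) _
start-history (suc (suc _)) _        (s≤s ())

walk-end : ∀ P x y x' y' → Walk x y P x' y' → (x + endX P ≡ x') × (y + endY P ≡ y')
walk-end []        x y x' y' (x≡ , y≡) = trans (+-identityʳ x) x≡ , trans (+-identityʳ y) y≡
walk-end (H d ∷ P) x y x' y' (_ , w) with walk-end P (suc x) y x' y' w
... | x≡ , y≡ = trans (+-suc x (endX P)) x≡ , y≡
walk-end (V ∷ P)   x y x' y' (_ , w) with walk-end P x (suc y) x' y' w
... | x≡ , y≡ = x≡ , trans (+-suc y (endY P)) y≡

-- A Dyck path ends on the diagonal, where the decoder holds a single item.
single-item-at-end : ∀ n P stk env → DecoderInv P (stk , env) → HDecPath n P → Σ Item λ i → stk ≡ i ∷ []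
single-item-at-end n P stk env I w = singleton stk (trans (stack-size I) (cong suc depth-zero))
  where
  ends : (endX P ≡ n) × (endY P ≡ n)
  ends = walk-end P 0 0 n n w
  depth-zero : depth I ≡ 0
  depth-zero = +-cancelˡ-≡ n (depth I) 0
    (trans (cong (_+ depth I) (sym (proj₂ ends))) (trans (sym (offset I)) (trans (proj₁ ends) (sym (+-identityʳ n)))))
  singleton : ∀ (xs : List Item) → length xs ≡ 1 → Σ Item λ i → xs ≡ i ∷ []
  singleton (i ∷ []) _ = i , refl

decode-CDyck : ∀ n P → CDyckPath n P → Σ RelaxedTree (λ T → HasSize n T × Compacted T × (Dyck T ≡ P))
decode-CDyck n P (walk , ccond) with run start P in run≡
... | stk , env with single-item-at-end n P stk env (subst (DecoderInv P) run≡ (decoder-invariant P [] start n n start-inv walk)) walk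
... | i , refl = T , proj₂ tree-ok , compacted , sym (spells I)
  where
  I : DecoderInv P (i ∷ [] , env)
  I = subst (DecoderInv P) run≡ (decoder-invariant P [] start n n start-inv walk)
  tree-ok : ValidPtrs (pointers i) (avail (subtree i)) × size (subtree i) ≡ n
  tree-ok = to (walk-Dyck-iff n (subtree i) (pointers i) (shape I)) (subst (λ Q → Walk 0 0 Q n n) (spells I) walk)
  T : RelaxedTree
  T = relaxed (subtree i) (pointers i) (proj₁ tree-ok)
  compacted : Compacted T
  compacted = subst Unique (sym (Bs-decoded T)) (subst (λ Q → Unique (proj₂ (run start Q))) (spells I)
    (subst Unique (sym (cong proj₂ run≡)) (LabelsInjective⇒Unique env
      (subst LabelsInjective (cong proj₂ run≡)
        (labels-stay-injective P [] start P n n start-inv start-injective start-history ccond refl walk)))))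

proposition2p10 :
    (n : ℕ) →
    ((T : RelaxedTree) → HasSize n T → Compacted T → CDyckPath n (Dyck T))
    × ((T T′ : RelaxedTree) → HasSize n T → Compacted T →
         HasSize n T′ → Compacted T′ → Dyck T ≡ Dyck T′ →
         (spine T ≡ spine T′) × (ptrs T ≡ ptrs T′))
    × ((P : List Step) → CDyckPath n P →
         Σ RelaxedTree (λ T → HasSize n T × Compacted T × (Dyck T ≡ P)))
proposition2p10 n =
    (λ T hasSize compacted → Dyck-walk n T hasSize , Dyck-CCondition n T hasSize compacted)
  , (λ T T′ _ _ _ _ same-path → Dyck-injective T T′ same-path)
  , decode-CDyck n
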